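{- Let $k\ge1$ and let $C$ be an odd cycle with vertices $x_0,x_1,\dots,x_{2k}$ in cyclic order. Let $H$ be a graph with $V(H)=V(C)\cup\{y_1,y_2,y_3\}$ such that: $E(C)\subseteq E(H)$; each $x_i$ is adjacent in $H$ to exactly one of $y_1,y_2,y_3$; $y_1y_2,y_2y_3,y_1y_3\in E(H)$; there are no other edges; and at most one of $y_1,y_2,y_3$ has degree $2$ in $H$. Then $H$ is $3$-colorable. -}

module Defs where

open import Data.Nat using (ℕ; suc; _+_; _*_; _%_)
open import Data.Fin using (Fin; toℕ)
open import Data.Bool using (Bool; true; false; if_then_else_)
open import Data.Sum using (_⊎_; inj₁; inj₂)
open import Data.Product using (_×_; Σ)
open import Relation.Binary.PropositionalEquality using (_≡_; _≢_)

count : ∀ n → (Fin n → Bool) → ℕ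
count ℕ.zero p = 0
count (suc n) p = (if p Fin.zero then 1 else 0) + count n (λ i → p (Fin.suc i))

record Graph (V : Set) : Set where
  field
    Adj   : V → V → Bool
    sym   : ∀ u v → Adj u v ≡ Adj v u
    loopless : ∀ v → Adj v v ≡ false

-- Vertex set V(C) ∪ {y₁,y₂,y₃}: inj₁ i is x_i (i < 2k+1), inj₂ j is y_{j+1}.
Vtx : ℕ → Set
Vtx n = Fin n ⊎ Fin 3

degree : ∀ {n} → Graph (Vtx n) → Vtx n → ℕ
degree {n} H v = count n (λ i → Graph.Adj H v (inj₁ i)) + count 3 (λ j → Graph.Adj H v (inj₂ j))

CycleEdge : ∀ m → Fin (suc m) → Fin (suc m) → Set
CycleEdge m i j = (toℕ j ≡ suc (toℕ i) % suc m) ⊎ (toℕ i ≡ suc (toℕ j) % suc m)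

ThreeColorable : ∀ {V : Set} → Graph V → Set
ThreeColorable {V} H = Σ (V → Fin 3) λ c → ∀ u v → Graph.Adj H u v ≡ true → c u ≢ c v

module Submission where

-- Colour each yⱼ with colour j.  Every cycle vertex xᵢ is attached
-- to exactly one y, say y_{f i}, so xᵢ must avoid the single colour f i: the
-- cycle has to be coloured from lists of two colours each.  Such a list
-- colouring of a cycle exists as soon as two consecutive vertices have
-- different forbidden colours f m ≢ f (m+1): colour greedily around the cycle
-- starting at x_{m+1} with colour f m, each vertex avoiding its forbidden
-- colour and its predecessor; the last vertex x_m then automatically differs
-- from x_{m+1} (it avoids f m).  If instead all f i equal one c, the two y's
-- other than y_c have no cycle neighbours, hence degree 2, contradicting the
-- degree hypothesis.

open import Defs
open import Data.Nat using (ℕ; suc; _+_; _*_; _≤_)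
open import Data.Fin using (Fin)
open import Data.Bool using (true)
open import Data.Sum using (inj₁; inj₂)
open import Data.Product using (_×_; ∃!)
open import Relation.Binary.PropositionalEquality using (_≡_; _≢_)
open import Function.Bundles using (_⇔_)

open import Data.Nat using (zero; _<_; _∸_; _%_; _≤?_; _<?_; z≤n; s≤s)
open import Data.Nat.Properties
  using (≤-refl; ≤-pred; <⇒≤; <⇒≱; ≰⇒>; ≤-antisym; m≤n⇒m<n∨m≡n; m∸n+n≡m; n∸n≡0; +-∸-assoc)
open import Data.Nat.DivMod using (m<n⇒m%n≡m; n%n≡0)
open import Data.Fin using (toℕ; fromℕ<) renaming (zero to fz; suc to fs)
open import Data.Fin.Properties using (toℕ<n; fromℕ<-toℕ) renaming (_≟_ to _≟ᶠ_)
open import Data.Bool using (Bool; false)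
open import Data.Sum using (_⊎_)
open import Data.Product using (Σ; _,_; proj₁; proj₂)
open import Data.Empty using (⊥-elim)
open import Relation.Nullary using (yes; no; ¬_)
open import Relation.Binary.PropositionalEquality using (refl; sym; trans; cong; subst)
open import Function.Bundles using (Equivalence)
open import Function using (case_of_)

Colour : Set
Colour = Fin 3

pattern c₀ = fz
pattern c₁ = fs fz
pattern c₂ = fs (fs fz)

other : Colour → Colour → Colour
other c₀ c₀ = c₁
other c₀ c₁ = c₂
other c₀ c₂ = c₁
other c₁ c₀ = c₂
other c₁ c₁ = c₀
other c₁ c₂ = c₀
other c₂ c₀ = c₁
other c₂ c₁ = c₀
other c₂ c₂ = c₀

other-avoids : ∀ a b → other a b ≢ a × other a b ≢ b
other-avoids c₀ c₀ = (λ ()) , (λ ())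
other-avoids c₀ c₁ = (λ ()) , (λ ())
other-avoids c₀ c₂ = (λ ()) , (λ ())
other-avoids c₁ c₀ = (λ ()) , (λ ())
other-avoids c₁ c₁ = (λ ()) , (λ ())
other-avoids c₁ c₂ = (λ ()) , (λ ())
other-avoids c₂ c₀ = (λ ()) , (λ ())
other-avoids c₂ c₁ = (λ ()) , (λ ())
other-avoids c₂ c₂ = (λ ()) , (λ ())

greedy : (forbidden : ℕ → Colour) → Colour → ℕ → Colour
greedy forbidden c zero    = c
greedy forbidden c (suc t) = other (forbidden (suc t)) (greedy forbidden c t)

greedy-avoids : ∀ forbidden c → c ≢ forbidden 0 → ∀ t → greedy forbidden c t ≢ forbidden t
greedy-avoids forbidden c c≢ zero    = c≢
greedy-avoids forbidden c c≢ (suc t) = proj₁ (other-avoids _ _)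

greedy-proper : ∀ forbidden c t → greedy forbidden c t ≢ greedy forbidden c (suc t)
greedy-proper forbidden c t eq = proj₂ (other-avoids _ _) (sym eq)

record CycleListColouring (M : ℕ) (forbidden : ℕ → Colour) : Set where
  field
    colour  : ℕ → Colour
    avoids  : ∀ i → colour i ≢ forbidden i
    steps   : ∀ i → i < M → colour i ≢ colour (suc i)
    closes  : colour M ≢ colour 0

-- Two consecutive different forbidden colours suffice for a list colouring of
-- the cycle: greedily colour m+1, …, M starting from colour `forbidden m`,
-- then 0, …, m continuing from the colour of M.
module BrokenCycle (M m : ℕ) (forbidden : ℕ → Colour)
                   (m<M : m < M) (break : forbidden m ≢ forbidden (suc m)) where

  -- colours of the vertices m+1, …, M, shifted to start at index 0
  tail : ℕ → Colour
  tail = greedy (λ t → forbidden (t + suc m)) (forbidden m)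

  head : ℕ → Colour
  head = greedy forbidden (other (forbidden 0) (tail (M ∸ suc m)))

  colour : ℕ → Colour
  colour i with i ≤? m
  ... | yes _ = head i
  ... | no  _ = tail (i ∸ suc m)

  colour-head : ∀ {i} → i ≤ m → colour i ≡ head i
  colour-head {i} i≤m with i ≤? m
  ... | yes _   = refl
  ... | no  i≰m = ⊥-elim (i≰m i≤m)

  colour-tail : ∀ {i} → m < i → colour i ≡ tail (i ∸ suc m)
  colour-tail {i} m<i with i ≤? m
  ... | yes i≤m = ⊥-elim (<⇒≱ m<i i≤m)
  ... | no  _   = refl

  -- head starts with a colour avoiding forbidden 0, tail with forbidden m,
  -- which differs from the first forbidden colour forbidden (m+1) of tail.
  head-avoids : ∀ i → head i ≢ forbidden i
  head-avoids = greedy-avoids forbidden _ (proj₁ (other-avoids _ _))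

  tail-avoids : ∀ t → tail t ≢ forbidden (t + suc m)
  tail-avoids = greedy-avoids _ (forbidden m) break

  avoids : ∀ i → colour i ≢ forbidden i
  avoids i with i ≤? m
  ... | yes _   = head-avoids i
  ... | no  i≰m = subst (λ j → tail (i ∸ suc m) ≢ forbidden j)
                        (m∸n+n≡m (≰⇒> i≰m)) (tail-avoids (i ∸ suc m))

  -- The junction m → m+1 is proper because tail 0 = forbidden m.
  steps : ∀ i → i < M → colour i ≢ colour (suc i)
  steps i i<M with suc i ≤? m
  ... | yes si≤m rewrite colour-head (<⇒≤ si≤m) = greedy-proper forbidden _ i
  ... | no  si≰m with i ≤? m
  ...   | yes i≤m rewrite ≤-antisym i≤m (≤-pred (≰⇒> si≰m)) | n∸n≡0 m = head-avoids m
  ...   | no  i≰m rewrite +-∸-assoc 1 (≰⇒> i≰m) =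
                      greedy-proper _ (forbidden m) (i ∸ suc m)

  closes : colour M ≢ colour 0
  closes eq = proj₂ (other-avoids _ _)
                (trans (sym (colour-head z≤n)) (trans (sym eq) (colour-tail m<M)))

  listColouring : CycleListColouring M forbidden
  listColouring = record { colour = colour ; avoids = avoids ; steps = steps ; closes = closes }

break-or-constant : (f : ℕ → Colour) → ∀ t →
  (Σ ℕ λ m → m < t × f m ≢ f (suc m)) ⊎ (∀ i → i ≤ t → f i ≡ f 0)
break-or-constant f zero = inj₂ λ { .0 z≤n → refl }
break-or-constant f (suc t) with break-or-constant f t
... | inj₁ (m , m<t , ne) = inj₁ (m , s≤s (<⇒≤ m<t) , ne)
... | inj₂ const with f t ≟ᶠ f (suc t)
...   | no  ne = inj₁ (t , ≤-refl , ne)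
...   | yes eq = inj₂ extend
  where
  extend : ∀ i → i ≤ suc t → f i ≡ f 0
  extend i i≤st with m≤n⇒m<n∨m≡n i≤st
  ... | inj₁ i<st = const i (≤-pred i<st)
  ... | inj₂ refl = trans (sym eq) (const t ≤-refl)

cycle-proper : ∀ M (colour : ℕ → Colour) →
  (∀ i → i < M → colour i ≢ colour (suc i)) → colour M ≢ colour 0 →
  ∀ (i j : Fin (suc M)) → toℕ j ≡ suc (toℕ i) % suc M → colour (toℕ i) ≢ colour (toℕ j)
cycle-proper M colour steps closes i j j≡i+1 eq with m≤n⇒m<n∨m≡n (≤-pred (toℕ<n i))
... | inj₁ i<M = steps (toℕ i) i<M (trans eq (cong colour j≡suc-i))
  where
  j≡suc-i : toℕ j ≡ suc (toℕ i)
  j≡suc-i = trans j≡i+1 (m<n⇒m%n≡m (s≤s i<M))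
... | inj₂ i≡M = closes (trans (cong colour (sym i≡M)) (trans eq (cong colour j≡0)))
  where
  j≡0 : toℕ j ≡ 0
  j≡0 = trans j≡i+1 (trans (cong (λ t → suc t % suc M) i≡M) (n%n≡0 (suc M)))

count-zero : ∀ n (p : Fin n → Bool) → (∀ i → p i ≡ false) → count n p ≡ 0
count-zero zero    p none = refl
count-zero (suc n) p none rewrite none fz = count-zero n (λ i → p (fs i)) (λ i → none (fs i))

not-true : ∀ {b} → ¬ b ≡ true → b ≡ false
not-true {false} _      = refl
not-true {true}  b≢true = ⊥-elim (b≢true refl)

module Attached {M : ℕ} (H : Graph (Vtx (suc M)))
  (attach : ∀ i → ∃! _≡_ (λ j → Graph.Adj H (inj₁ i) (inj₂ j) ≡ true))
  (triangle : ∀ j j′ → j ≢ j′ → Graph.Adj H (inj₂ j) (inj₂ j′) ≡ true) where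

  open Graph H renaming (sym to Adj-sym)

  attachment : Fin (suc M) → Colour
  attachment i = proj₁ (attach i)

  attached-only : ∀ {i j} → Adj (inj₁ i) (inj₂ j) ≡ true → j ≡ attachment i
  attached-only {i} adj = sym (proj₂ (proj₂ (attach i)) adj)

  -- the attachments as a sequence indexed by naturals (arbitrary beyond M)
  forbidden : ℕ → Colour
  forbidden t with t <? suc M
  ... | yes t<n = attachment (fromℕ< t<n)
  ... | no  _   = c₀

  forbidden-toℕ : ∀ i → forbidden (toℕ i) ≡ attachment i
  forbidden-toℕ i with toℕ i <? suc M
  ... | yes i<n = cong attachment (fromℕ<-toℕ i i<n)
  ... | no  i≮n = ⊥-elim (i≮n (toℕ<n i))

  triangle-count : ∀ j → count 3 (λ j′ → Adj (inj₂ j) (inj₂ j′)) ≡ 2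
  triangle-count c₀ rewrite loopless (inj₂ c₀) | triangle c₀ c₁ (λ ()) | triangle c₀ c₂ (λ ()) = refl
  triangle-count c₁ rewrite loopless (inj₂ c₁) | triangle c₁ c₀ (λ ()) | triangle c₁ c₂ (λ ()) = refl
  triangle-count c₂ rewrite loopless (inj₂ c₂) | triangle c₂ c₀ (λ ()) | triangle c₂ c₁ (λ ()) = refl

  no-cycle-neighbour : ∀ j → (∀ i → attachment i ≢ j) → ∀ i → Adj (inj₂ j) (inj₁ i) ≡ false
  no-cycle-neighbour j unattached i = not-true λ adj →
    unattached i (sym (attached-only (trans (Adj-sym (inj₁ i) (inj₂ j)) adj)))

  unattached-degree : ∀ j → (∀ i → attachment i ≢ j) → degree H (inj₂ j) ≡ 2
  unattached-degree j unattached
    rewrite count-zero (suc M) (λ i → Adj (inj₂ j) (inj₁ i)) (no-cycle-neighbour j unattached)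
          | triangle-count j = refl

  not-constant : (∀ j j′ → degree H (inj₂ j) ≡ 2 → degree H (inj₂ j′) ≡ 2 → j ≡ j′) →
    ¬ (∀ t → t ≤ M → forbidden t ≡ forbidden 0)
  not-constant atMostOneDegree2 constant =
    proj₂ (other-avoids c j) (sym (atMostOneDegree2 j j′ (unattached-degree j  (avoid c))
                                                       (unattached-degree j′ (avoid j))))
    where
    c  = forbidden 0
    j  = other c c
    j′ = other c j
    all-c : ∀ i → attachment i ≡ c
    all-c i = trans (sym (forbidden-toℕ i)) (constant (toℕ i) (≤-pred (toℕ<n i)))
    avoid : ∀ a → ∀ i → attachment i ≢ other c a
    avoid a i eq = proj₁ (other-avoids c a) (trans (sym eq) (all-c i))

  threeColouring : (∀ i j → (Adj (inj₁ i) (inj₁ j) ≡ true) ⇔ CycleEdge M i j) →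
    CycleListColouring M forbidden → ThreeColorable H
  threeColouring cycle L = colourOf , proper
    where
    open CycleListColouring L

    colourOf : Vtx (suc M) → Colour
    colourOf (inj₁ i) = colour (toℕ i)
    colourOf (inj₂ j) = j

    cycle-edge : ∀ i j → toℕ j ≡ suc (toℕ i) % suc M → colour (toℕ i) ≢ colour (toℕ j)
    cycle-edge = cycle-proper M colour steps closes

    attachment-edge : ∀ i j → Adj (inj₁ i) (inj₂ j) ≡ true → colour (toℕ i) ≢ j
    attachment-edge i j adj eq =
      avoids (toℕ i) (trans eq (trans (attached-only adj) (sym (forbidden-toℕ i))))

    proper : ∀ u v → Adj u v ≡ true → colourOf u ≢ colourOf v
    proper (inj₁ i) (inj₁ j) adj with Equivalence.to (cycle i j) adj
    ... | inj₁ j≡i+1 = cycle-edge i j j≡i+1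
    ... | inj₂ i≡j+1 = λ eq → cycle-edge j i i≡j+1 (sym eq)
    proper (inj₁ i) (inj₂ j) adj = attachment-edge i j adj
    proper (inj₂ j) (inj₁ i) adj = λ eq → attachment-edge i j (trans (Adj-sym (inj₁ i) (inj₂ j)) adj) (sym eq)
    proper (inj₂ j) (inj₂ j′) adj with j ≟ᶠ j′
    ... | no  j≢j′ = j≢j′
    ... | yes refl with trans (sym (loopless (inj₂ j))) adj
    ...   | ()

lemma10 : (k : ℕ) → 1 ≤ k → (H : Graph (Vtx (suc (2 * k)))) →
    (∀ i j → (Graph.Adj H (inj₁ i) (inj₁ j) ≡ true) ⇔ CycleEdge (2 * k) i j) →
    (∀ i → ∃! _≡_ (λ j → Graph.Adj H (inj₁ i) (inj₂ j) ≡ true)) →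
    (∀ j j′ → j ≢ j′ → Graph.Adj H (inj₂ j) (inj₂ j′) ≡ true) →
    (∀ j j′ → degree H (inj₂ j) ≡ 2 → degree H (inj₂ j′) ≡ 2 → j ≡ j′) →
    ThreeColorable H
lemma10 k _ H cycle attach triangle atMostOneDegree2 =
  case break-or-constant forbidden (2 * k) of λ where
    (inj₁ (m , m<2k , break)) →
      threeColouring cycle (BrokenCycle.listColouring (2 * k) m forbidden m<2k break)
    (inj₂ constant) → ⊥-elim (not-constant atMostOneDegree2 constant)
  where open Attached H attach triangle
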